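{- For all integers $n\ge0$ and $k\ge0$: $T(3,n;k)>0$ if and only if $k\le\lfloor(3n+1)/2\rfloor$. Equivalently, for all integers $k\ge0$ and $n\ge0$: $T(3,n;k)>0$ if and only if $n\ge\lfloor(2k+1)/3\rfloor$.
   Context: For integers $n\ge0$ and $k\ge0$, $T(3,n;k)$ denotes the number of ways to select a set of $k$ squares from a $3\times n$ rectangular grid of unit squares ($3$ rows, $n$ columns) such that no two selected squares are horizontally or vertically adjacent (share an edge); $T(3,0;0)=1$ and $T(3,0;k)=0$ for $k>0$. -}

module Defs where

open import Data.Bool using (Bool; true; false; _∧_; _∨_; not)
open import Data.Nat using (ℕ; zero; suc; _+_)
open import Data.List using (List; []; _∷_; length; filterᵇ; concatMap; map)
open import Data.Vec using (Vec; []; _∷_; lookup; tabulate)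
open import Data.Fin using (Fin)
open import Relation.Binary.PropositionalEquality using (_≡_)
open import Data.Nat using (_≟_)
open import Relation.Nullary.Decidable using (⌊_⌋)

-- A selection of squares in a 3 × n grid: for each of the n columns,
-- a column given by 3 booleans (row 0, row 1, row 2); true = selected.
-- Such assignments are in bijection with subsets of the 3n squares.
Column : Set
Column = Vec Bool 3

Grid : ℕ → Set
Grid n = Vec Column n

allColumns : List Column
allColumns =
  concatMap (λ a → concatMap (λ b → map (λ c → a ∷ b ∷ c ∷ []) (true ∷ false ∷ []))
                              (true ∷ false ∷ []))
            (true ∷ false ∷ [])

allGrids : (n : ℕ) → List (Grid n)
allGrids zero = [] ∷ []
allGrids (suc n) = concatMap (λ c → map (c ∷_) (allGrids n)) allColumns

colOK : Column → Bool
colOK (a ∷ b ∷ c ∷ []) = not (a ∧ b) ∧ not (b ∧ c)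

pairOK : Column → Column → Bool
pairOK (a ∷ b ∷ c ∷ []) (a' ∷ b' ∷ c' ∷ []) = not (a ∧ a') ∧ not (b ∧ b') ∧ not (c ∧ c')

independent : {n : ℕ} → Grid n → Bool
independent [] = true
independent (c ∷ []) = colOK c
independent (c ∷ d ∷ g) = colOK c ∧ pairOK c d ∧ independent (d ∷ g)

b2n : Bool → ℕ
b2n true = 1
b2n false = 0

colCount : Column → ℕ
colCount (a ∷ b ∷ c ∷ []) = b2n a + b2n b + b2n c

count : {n : ℕ} → Grid n → ℕ
count [] = 0
count (c ∷ g) = colCount c + count g

T3 : ℕ → ℕ → ℕ
T3 n k = length (filterᵇ (λ g → independent g ∧ ⌊ count g ≟ k ⌋) (allGrids n))

module Submission where

-- Hence T3 n k > 0
-- exactly when some independent grid with k squares exists (k is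
-- "realizable" on n columns), and the theorem reduces to
--
--        k is realizable on n columns  ⇔  2k ≤ 3n + 1.
--
-- (⇒) Two neighbouring columns share each of the three rows, so together
--     they hold at most 3 squares, and a single column holds at most 2;
--     cutting the grid into pairs of columns plus possibly one last column
--     gives 2k ≤ 3n + 1.
-- (⇐) Alternate "outer" columns (squares only in rows 0 and 2) with
--     "inner" columns (a square only in row 1), filling greedily from the
--     left until k squares are placed; this grid is independent and holds
--     any k with 2k ≤ 3n + 1.
-- Two facts about floor division then turn 2k ≤ 3n + 1 into the two
-- stated forms k ≤ ⌊(3n+1)/2⌋ and n ≥ ⌊(2k+1)/3⌋.

open import Defs
open import Data.Nat using (ℕ; _+_; _*_; _≤_; _<_; _≥_; _/_)
open import Data.Product using (_×_)
open import Function.Bundles using (_⇔_)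

open import Data.Bool using (Bool; true; false; _∧_; not; T)
open import Data.Bool.Properties using (T-∧)
open import Data.List using (List; []; _∷_; length; filterᵇ; map; concatMap)
open import Data.List.Membership.Propositional using (_∈_; lose)
open import Data.List.Membership.Propositional.Properties using (∈-filter⁻; ∈-map⁺; ∈-concatMap⁺)
open import Data.List.Properties using (filter-some)
open import Data.List.Relation.Unary.Any using (here; there)
open import Data.Nat using (zero; suc; z≤n; s≤s; s≤s⁻¹; NonZero; _<?_; _≟_)
open import Data.Nat.DivMod using (m/n*n≤m; /-monoˡ-≤; m*n/n≡m; m<n*o⇒m/o<n)
open import Data.Nat.Properties
open import Data.Nat.Tactic.RingSolver using (solve-∀)
open import Data.Product using (Σ; _,_; proj₁; proj₂)
open import Data.Unit using (tt)
open import Data.Vec using ([]; _∷_)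
open import Function using (_∘_)
open import Function.Bundles using (mk⇔; Equivalence)
open import Function.Properties.Equivalence using () renaming (trans to ⇔-trans; sym to ⇔-sym)
open import Relation.Binary.PropositionalEquality using (_≡_; refl; sym; cong; subst₂)
open import Relation.Nullary using (contradiction)
open import Relation.Nullary.Decidable using (yes; no; T?; ⌊_⌋; toWitness; fromWitness)

open Equivalence using (to; from)

nonempty-member : ∀ {A : Set} (ys : List A) → 0 < length ys → Σ A (_∈ ys)
nonempty-member (y ∷ _) _ = y , here refl

filterᵇ-nonempty : ∀ {A : Set} (p : A → Bool) (xs : List A) →
                   (0 < length (filterᵇ p xs)) ⇔ Σ A (λ x → x ∈ xs × T (p x))
filterᵇ-nonempty {A} p xs = mk⇔ member-passes (λ (_ , x∈xs , px) → filter-some (T? ∘ p) (lose x∈xs px))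
  where
  member-passes : 0 < length (filterᵇ p xs) → Σ A (λ x → x ∈ xs × T (p x))
  member-passes h with nonempty-member (filterᵇ p xs) h
  ... | x , x∈filter = x , ∈-filter⁻ (T? ∘ p) x∈filter

bool-listed : ∀ b → b ∈ true ∷ false ∷ []
bool-listed true  = here refl
bool-listed false = there (here refl)

column-listed : ∀ c → c ∈ allColumns
column-listed (a ∷ b ∷ c ∷ []) =
  ∈-concatMap⁺ (λ a → concatMap (λ b → map (λ c → a ∷ b ∷ c ∷ []) bools) bools)
    (lose (bool-listed a)
      (∈-concatMap⁺ (λ b → map (λ c → a ∷ b ∷ c ∷ []) bools)
        (lose (bool-listed b) (∈-map⁺ (λ c → a ∷ b ∷ c ∷ []) (bool-listed c)))))
  where bools = true ∷ false ∷ []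

grid-listed : ∀ {n} (g : Grid n) → g ∈ allGrids n
grid-listed []                = here refl
grid-listed {suc n} (c ∷ g) =
  ∈-concatMap⁺ (λ c → map (c ∷_) (allGrids n))
    (lose (column-listed c) (∈-map⁺ (c ∷_) (grid-listed g)))

Realizable : ℕ → ℕ → Set
Realizable n k = Σ (Grid n) λ g → T (independent g) × count g ≡ k

T3-positive : ∀ n k → (0 < T3 n k) ⇔ Realizable n k
T3-positive n k = ⇔-trans (filterᵇ-nonempty selected (allGrids n)) (mk⇔ forget-listing list)
  where
  selected : Grid n → Bool
  selected g = independent g ∧ ⌊ count g ≟ k ⌋
  forget-listing : Σ (Grid n) (λ g → g ∈ allGrids n × T (selected g)) → Realizable n k
  forget-listing (g , _ , ok) with to (T-∧ {independent g}) ok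
  ... | ind , cnt = g , ind , toWitness cnt
  list : Realizable n k → Σ (Grid n) (λ g → g ∈ allGrids n × T (selected g))
  list (g , ind , cnt) = g , grid-listed g , from (T-∧ {independent g}) (ind , fromWitness cnt)

first-pair-ok : ∀ {n} c d (g : Grid n) → T (independent (c ∷ d ∷ g)) → T (pairOK c d)
first-pair-ok c d g ok = proj₁ (to (T-∧ {pairOK c d}) (proj₂ (to (T-∧ {colOK c}) ok)))

tail-independent : ∀ {n} c (g : Grid n) → T (independent (c ∷ g)) → T (independent g)
tail-independent c []      ok = tt
tail-independent c (d ∷ g) ok = proj₂ (to (T-∧ {pairOK c d}) (proj₂ (to (T-∧ {colOK c}) ok)))

row-pair-bound : ∀ a a' → T (not (a ∧ a')) → b2n a + b2n a' ≤ 1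
row-pair-bound true  false _ = ≤-refl
row-pair-bound false true  _ = ≤-refl
row-pair-bound false false _ = z≤n

column-pair-bound : ∀ c d → T (pairOK c d) → colCount c + colCount d ≤ 3
column-pair-bound (a ∷ b ∷ c ∷ []) (a' ∷ b' ∷ c' ∷ []) ok
  with to (T-∧ {not (a ∧ a')}) ok
... | row₀ , rows₁₂ with to (T-∧ {not (b ∧ b')}) rows₁₂
... | row₁ , row₂ = begin
  (b2n a + b2n b + b2n c) + (b2n a' + b2n b' + b2n c')
    ≡⟨ regroup (b2n a) (b2n b) (b2n c) (b2n a') (b2n b') (b2n c') ⟩
  (b2n a + b2n a') + (b2n b + b2n b') + (b2n c + b2n c')
    ≤⟨ +-mono-≤ (+-mono-≤ (row-pair-bound a a' row₀) (row-pair-bound b b' row₁))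
                (row-pair-bound c c' row₂) ⟩
  3 ∎
  where
  open ≤-Reasoning
  regroup : ∀ x y z x' y' z' → (x + y + z) + (x' + y' + z') ≡ (x + x') + (y + y') + (z + z')
  regroup = solve-∀

column-bound : ∀ c → T (colOK c) → colCount c ≤ 2
column-bound (a ∷ false ∷ c ∷ [])    _  = +-mono-≤ (+-mono-≤ {b2n a} {1} {0} {0} (b2n≤1 a) z≤n) (b2n≤1 c)
  where
  b2n≤1 : ∀ x → b2n x ≤ 1
  b2n≤1 true  = ≤-refl
  b2n≤1 false = z≤n
column-bound (false ∷ true ∷ false ∷ []) _  = s≤s z≤n
column-bound (true ∷ true ∷ _ ∷ [])     ()
column-bound (false ∷ true ∷ true ∷ [])  ()

-- Upper bound: an independent selection in a 3 × n grid has 2k ≤ 3n + 1,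
-- by peeling off two columns (≤ 3 squares) at a time.
independent-bound : ∀ {n} (g : Grid n) → T (independent g) → 2 * count g ≤ 3 * n + 1
independent-bound []            _  = z≤n
independent-bound (c ∷ [])      ok = begin
  2 * (colCount c + 0) ≡⟨ cong (2 *_) (+-identityʳ (colCount c)) ⟩
  2 * colCount c       ≤⟨ *-monoʳ-≤ 2 (column-bound c ok) ⟩
  4                    ∎
  where open ≤-Reasoning
independent-bound {suc (suc n)} (c ∷ d ∷ g) ok = begin
  2 * (colCount c + (colCount d + count g))
    ≡⟨ cong (2 *_) (sym (+-assoc (colCount c) (colCount d) (count g))) ⟩
  2 * ((colCount c + colCount d) + count g)
    ≡⟨ *-distribˡ-+ 2 (colCount c + colCount d) (count g) ⟩
  2 * (colCount c + colCount d) + 2 * count g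
    ≤⟨ +-mono-≤ (*-monoʳ-≤ 2 (column-pair-bound c d (first-pair-ok c d g ok)))
                (independent-bound g (tail-independent d g (tail-independent c (d ∷ g) ok))) ⟩
  6 + (3 * n + 1)
    ≡⟨ two-more-columns n ⟩
  3 * suc (suc n) + 1 ∎
  where
  open ≤-Reasoning
  two-more-columns : ∀ n → 6 + (3 * n + 1) ≡ 3 * suc (suc n) + 1
  two-more-columns = solve-∀

-- Outer columns use rows 0 and 2, inner
-- columns only row 1; `outer n k` starts with an outer column and
-- `inner n k` with an inner one, each placing as many of the remaining
-- k squares as its first column allows and alternating afterwards.
blank top top-bottom middle : Column
blank      = false ∷ false ∷ false ∷ []
top        = true  ∷ false ∷ false ∷ []
top-bottom = true  ∷ false ∷ true  ∷ []
middle     = false ∷ true  ∷ false ∷ []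

outer inner : (n k : ℕ) → Grid n
outer zero    _             = []
outer (suc n) zero          = blank      ∷ inner n zero
outer (suc n) (suc zero)    = top        ∷ inner n zero
outer (suc n) (suc (suc k)) = top-bottom ∷ inner n k
inner zero    _       = []
inner (suc n) zero    = blank  ∷ outer n zero
inner (suc n) (suc k) = middle ∷ outer n k

three-more : ∀ n → 3 * suc n ≡ 2 + (3 * n + 1)
three-more = solve-∀

-- Capacity: `outer n` holds any k with 2k ≤ 3n + 1, `inner n` any k with
-- 2k ≤ 3n (the next column is of the other kind, with fewer columns left).
outer-capacity-step : ∀ k n → 2 * (2 + k) ≤ 3 * (1 + n) + 1 → 2 * k ≤ 3 * n
outer-capacity-step k n h = +-cancelˡ-≤ 4 _ _ (subst₂ _≤_ (lhs k) (rhs n) h)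
  where
  lhs : ∀ k → 2 * (2 + k) ≡ 4 + 2 * k
  lhs = solve-∀
  rhs : ∀ n → 3 * (1 + n) + 1 ≡ 4 + 3 * n
  rhs = solve-∀

inner-capacity-step : ∀ k n → 2 * (1 + k) ≤ 3 * (1 + n) → 2 * k ≤ 3 * n + 1
inner-capacity-step k n h = +-cancelˡ-≤ 2 _ _ (subst₂ _≤_ (lhs k) (three-more n) h)
  where
  lhs : ∀ k → 2 * (1 + k) ≡ 2 + 2 * k
  lhs = solve-∀

count-outer : ∀ n k → 2 * k ≤ 3 * n + 1 → count (outer n k) ≡ k
count-inner : ∀ n k → 2 * k ≤ 3 * n → count (inner n k) ≡ k
count-outer zero    zero          _ = refl
count-outer zero    (suc zero)    (s≤s ())
count-outer zero    (suc (suc k)) (s≤s ())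
count-outer (suc n) zero          _ = count-inner n zero z≤n
count-outer (suc n) (suc zero)    _ = cong suc (count-inner n zero z≤n)
count-outer (suc n) (suc (suc k)) h = cong (2 +_) (count-inner n k (outer-capacity-step k n h))
count-inner zero    zero    _ = refl
count-inner zero    (suc k) ()
count-inner (suc n) zero    _ = count-outer n zero z≤n
count-inner (suc n) (suc k) h = cong suc (count-outer n k (inner-capacity-step k n h))

fits : ∀ {n} → Column → Grid n → Bool
fits c []      = true
fits c (d ∷ _) = pairOK c d

prepend-independent : ∀ {n} c (g : Grid n) → T (colOK c) → T (fits c g) →
                      T (independent g) → T (independent (c ∷ g))
prepend-independent c []      col _   _   = col
prepend-independent c (d ∷ g) col fit ind = from T-∧ (col , from T-∧ (fit , ind))

-- Outer and inner columns never share a row.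
outer-before-inner : ∀ a c b → T (pairOK (a ∷ false ∷ c ∷ []) (false ∷ b ∷ false ∷ []))
outer-before-inner true  true  _ = tt
outer-before-inner true  false _ = tt
outer-before-inner false true  _ = tt
outer-before-inner false false _ = tt

inner-before-outer : ∀ b a c → T (pairOK (false ∷ b ∷ false ∷ []) (a ∷ false ∷ c ∷ []))
inner-before-outer true  _ _ = tt
inner-before-outer false _ _ = tt

outer-column-fits : ∀ a c n k → T (fits (a ∷ false ∷ c ∷ []) (inner n k))
outer-column-fits a c zero    _       = tt
outer-column-fits a c (suc n) zero    = outer-before-inner a c false
outer-column-fits a c (suc n) (suc k) = outer-before-inner a c true

inner-column-fits : ∀ b n k → T (fits (false ∷ b ∷ false ∷ []) (outer n k))
inner-column-fits b zero    _             = tt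
inner-column-fits b (suc n) zero          = inner-before-outer b false false
inner-column-fits b (suc n) (suc zero)    = inner-before-outer b true false
inner-column-fits b (suc n) (suc (suc k)) = inner-before-outer b true true

outer-independent : ∀ n k → T (independent (outer n k))
inner-independent : ∀ n k → T (independent (inner n k))
outer-independent zero _ = tt
outer-independent (suc n) zero =
  prepend-independent blank (inner n zero) tt (outer-column-fits false false n zero) (inner-independent n zero)
outer-independent (suc n) (suc zero) =
  prepend-independent top (inner n zero) tt (outer-column-fits true false n zero) (inner-independent n zero)
outer-independent (suc n) (suc (suc k)) =
  prepend-independent top-bottom (inner n k) tt (outer-column-fits true true n k) (inner-independent n k)
inner-independent zero _ = tt
inner-independent (suc n) zero =
  prepend-independent blank (outer n zero) tt (inner-column-fits false n zero) (outer-independent n zero)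
inner-independent (suc n) (suc k) =
  prepend-independent middle (outer n k) tt (inner-column-fits true n k) (outer-independent n k)

realizable⇔ : ∀ n k → Realizable n k ⇔ (2 * k ≤ 3 * n + 1)
realizable⇔ n k = mk⇔ bound construct
  where
  bound : Realizable n k → 2 * k ≤ 3 * n + 1
  bound (g , ind , refl) = independent-bound g ind
  construct : 2 * k ≤ 3 * n + 1 → Realizable n k
  construct h = outer n k , outer-independent n k , count-outer n k h

characterization : ∀ n k → (0 < T3 n k) ⇔ (2 * k ≤ 3 * n + 1)
characterization n k = ⇔-trans (T3-positive n k) (realizable⇔ n k)

≤-/⇔ : ∀ k m d .{{_ : NonZero d}} → (k ≤ m / d) ⇔ (d * k ≤ m)
≤-/⇔ k m d = mk⇔ multiply divide
  where
  multiply : k ≤ m / d → d * k ≤ m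
  multiply h = begin
    d * k     ≡⟨ *-comm d k ⟩
    k * d     ≤⟨ *-monoˡ-≤ d h ⟩
    m / d * d ≤⟨ m/n*n≤m m d ⟩
    m         ∎
    where open ≤-Reasoning
  divide : d * k ≤ m → k ≤ m / d
  divide h = begin
    k         ≡⟨ sym (m*n/n≡m k d) ⟩
    k * d / d ≤⟨ /-monoˡ-≤ d (≤-trans (≤-reflexive (*-comm k d)) h) ⟩
    m / d     ∎
    where open ≤-Reasoning

/-≤⇔ : ∀ m n d .{{_ : NonZero d}} → (m / d ≤ n) ⇔ (m < d * suc n)
/-≤⇔ m n d = mk⇔ below-next bounded
  where
  bounded : m < d * suc n → m / d ≤ n
  bounded h = s≤s⁻¹ (m<n*o⇒m/o<n (≤-trans h (≤-reflexive (*-comm d (suc n)))))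
  below-next : m / d ≤ n → m < d * suc n
  below-next h with m <? d * suc n
  ... | yes m<d[n+1] = m<d[n+1]
  ... | no  m≮d[n+1] = contradiction (from (≤-/⇔ (suc n) m d) (≮⇒≥ m≮d[n+1])) (≤⇒≯ h)

odd-below-thrice⇔ : ∀ k n → (2 * k + 1 < 3 * suc n) ⇔ (2 * k ≤ 3 * n + 1)
odd-below-thrice⇔ k n = mk⇔
  (λ h → +-cancelˡ-≤ 2 _ _ (subst₂ _≤_ (two-more k) (three-more n) h))
  (λ h → subst₂ _≤_ (sym (two-more k)) (sym (three-more n)) (+-monoʳ-≤ 2 h))
  where
  two-more : ∀ k → suc (2 * k + 1) ≡ 2 + 2 * k
  two-more = solve-∀

proposition6 : ((n k : ℕ) → (0 < T3 n k) ⇔ (k ≤ (3 * n + 1) / 2))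
    × ((k n : ℕ) → (0 < T3 n k) ⇔ (n ≥ (2 * k + 1) / 3))
proposition6 =
    (λ n k → ⇔-trans (characterization n k) (⇔-sym (≤-/⇔ k (3 * n + 1) 2)))
  , (λ k n → ⇔-trans (characterization n k)
                     (⇔-sym (⇔-trans (/-≤⇔ (2 * k + 1) n 3) (odd-below-thrice⇔ k n))))
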